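{- Each of the rules $\mathsf w_\forall$, $\mathsf c_\forall$, $\mathsf m$, $\mathsf m_\forall$, $\mathsf m_\exists$ is derivable in $\{\mathsf w,\mathsf c,\equiv\}$: for every instance of one of these rules with premise $P$ and conclusion $Q$, there is a derivation from $P$ to $Q$ using only the rules $\mathsf w$, $\mathsf c$ and $\equiv$.
   Context: Formulas: terms $t::=x\mid f(t_1,\dots,t_n)$; atoms $a::=\mathsf t\mid\mathsf f\mid p(\vec t)\mid\bar p(\vec t)$; formulas $A::=a\mid A\wedge A\mid A\vee A\mid\exists x.A\mid\forall x.A$. $\equiv$ is the smallest congruence with $\wedge,\vee$ commutative and associative, $\forall x\forall y.A\equiv\forall y\forall x.A$, $\exists x\exists y.A\equiv\exists y\exists x.A$, $\forall x.(A\vee B)\equiv(\forall x.A)\vee B$, $\exists x.(A\wedge B)\equiv(\exists x.A)\wedge B$ ($x$ not free in $B$). A context $S\{\ \}$ is a formula with one hole in place of an atom. A derivation from $B$ to $A$ is a finite sequence of formulas from $B$ to $A$, each step a rule instance. Rules (premise $\Rightarrow$ conclusion in any context $S$): $\mathsf w$: $S\{A\}\Rightarrow S\{A\vee B\}$; $\mathsf c$: $S\{A\vee A\}\Rightarrow S\{A\}$; $\equiv$: $S\{B\}\Rightarrow S\{A\}$ if $A\equiv B$; $\mathsf m$: $S\{(A\wedge C)\vee(B\wedge D)\}\Rightarrow S\{(A\vee B)\wedge(C\vee D)\}$; $\mathsf m_\forall$: $S\{(\forall x.A)\vee(\forall x.B)\}\Rightarrow S\{\forall x.(A\vee B)\}$;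 $\mathsf m_\exists$: $S\{(\exists x.A)\vee(\exists x.B)\}\Rightarrow S\{\exists x.(A\vee B)\}$; $\mathsf w_\forall$: $S\{A\}\Rightarrow S\{\forall x.A\}$ ($x$ not free in $A$); $\mathsf c_\forall$: $S\{\forall x.\forall x.A\}\Rightarrow S\{\forall x.A\}$. -}

module Defs where

open import Data.Nat using (ℕ)
open import Data.List using (List)
open import Data.List.Relation.Unary.Any using (Any)
open import Data.Product using (_×_; ∃-syntax)
open import Data.Sum using (_⊎_)
open import Relation.Nullary using (¬_)
open import Relation.Binary.PropositionalEquality using (_≡_; _≢_)
open import Relation.Binary.Construct.Closure.ReflexiveTransitive using (Star)

-- Variables, function symbols and predicate symbols are named by natural numbers;
-- arity is given by the length of the argument list.
Var : Set
Var = ℕ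

data Term : Set where
  var : Var → Term
  fn  : ℕ → List Term → Term

data Atom : Set where
  tt  : Atom
  ff  : Atom
  pos : ℕ → List Term → Atom
  neg : ℕ → List Term → Atom

infixr 6 _∧_
infixr 5 _∨_
data Formula : Set where
  atom : Atom → Formula
  _∧_  : Formula → Formula → Formula
  _∨_  : Formula → Formula → Formula
  ex   : Var → Formula → Formula
  all  : Var → Formula → Formula

data FreeT (x : Var) : Term → Set where
  here : FreeT x (var x)
  arg  : ∀ {f ts} → Any (FreeT x) ts → FreeT x (fn f ts)

data FreeA (x : Var) : Atom → Set where
  inPos : ∀ {p ts} → Any (FreeT x) ts → FreeA x (pos p ts)
  inNeg : ∀ {p ts} → Any (FreeT x) ts → FreeA x (neg p ts)

data Free (x : Var) : Formula → Set where
  inAtom : ∀ {a} → FreeA x a → Free x (atom a)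
  ∧ˡ : ∀ {A B} → Free x A → Free x (A ∧ B)
  ∧ʳ : ∀ {A B} → Free x B → Free x (A ∧ B)
  ∨ˡ : ∀ {A B} → Free x A → Free x (A ∨ B)
  ∨ʳ : ∀ {A B} → Free x B → Free x (A ∨ B)
  inEx  : ∀ {y A} → y ≢ x → Free x A → Free x (ex y A)
  inAll : ∀ {y A} → y ≢ x → Free x A → Free x (all y A)

infix 4 _≈_
data _≈_ : Formula → Formula → Set where
  ≈-refl  : ∀ {A} → A ≈ A
  ≈-sym   : ∀ {A B} → A ≈ B → B ≈ A
  ≈-trans : ∀ {A B C} → A ≈ B → B ≈ C → A ≈ C
  ∧-cong  : ∀ {A A' B B'} → A ≈ A' → B ≈ B' → (A ∧ B) ≈ (A' ∧ B')
  ∨-cong  : ∀ {A A' B B'} → A ≈ A' → B ≈ B' → (A ∨ B) ≈ (A' ∨ B')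
  ex-cong  : ∀ {x A A'} → A ≈ A' → ex x A ≈ ex x A'
  all-cong : ∀ {x A A'} → A ≈ A' → all x A ≈ all x A'
  ∧-comm  : ∀ {A B} → (A ∧ B) ≈ (B ∧ A)
  ∨-comm  : ∀ {A B} → (A ∨ B) ≈ (B ∨ A)
  ∧-assoc : ∀ {A B C} → ((A ∧ B) ∧ C) ≈ (A ∧ (B ∧ C))
  ∨-assoc : ∀ {A B C} → ((A ∨ B) ∨ C) ≈ (A ∨ (B ∨ C))
  all-swap : ∀ {x y A} → all x (all y A) ≈ all y (all x A)
  ex-swap  : ∀ {x y A} → ex x (ex y A) ≈ ex y (ex x A)
  all-scope : ∀ {x A B} → ¬ Free x B → all x (A ∨ B) ≈ (all x A ∨ B)
  ex-scope  : ∀ {x A B} → ¬ Free x B → ex x (A ∧ B) ≈ (ex x A ∧ B)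

data Context : Set where
  □    : Context
  _∧ₗ_ : Context → Formula → Context
  _∧ᵣ_ : Formula → Context → Context
  _∨ₗ_ : Context → Formula → Context
  _∨ᵣ_ : Formula → Context → Context
  exC  : Var → Context → Context
  allC : Var → Context → Context

_[_] : Context → Formula → Formula
□ [ A ] = A
(S ∧ₗ B) [ A ] = (S [ A ]) ∧ B
(B ∧ᵣ S) [ A ] = B ∧ (S [ A ])
(S ∨ₗ B) [ A ] = (S [ A ]) ∨ B
(B ∨ᵣ S) [ A ] = B ∨ (S [ A ])
exC x S [ A ] = ex x (S [ A ])
allC x S [ A ] = all x (S [ A ])

data RuleName : Set where
  w c eqv m m∀ m∃ w∀ c∀ : RuleName

-- Inst r P Q : the rule r (outside of any context) has premise P and conclusion Q
data Inst : RuleName → Formula → Formula → Set where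
  w-inst   : ∀ {A B} → Inst w A (A ∨ B)
  c-inst   : ∀ {A} → Inst c (A ∨ A) A
  eqv-inst : ∀ {A B} → A ≈ B → Inst eqv B A
  m-inst   : ∀ {A B C D} → Inst m ((A ∧ C) ∨ (B ∧ D)) ((A ∨ B) ∧ (C ∨ D))
  m∀-inst  : ∀ {x A B} → Inst m∀ (all x A ∨ all x B) (all x (A ∨ B))
  m∃-inst  : ∀ {x A B} → Inst m∃ (ex x A ∨ ex x B) (ex x (A ∨ B))
  w∀-inst  : ∀ {x A} → ¬ Free x A → Inst w∀ A (all x A)
  c∀-inst  : ∀ {x A} → Inst c∀ (all x (all x A)) (all x A)

Step : RuleName → Formula → Formula → Set
Step r P Q = ∃[ S ] ∃[ A ] ∃[ B ] (Inst r A B × P ≡ S [ A ] × Q ≡ S [ B ])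

data InWC≡ : RuleName → Set where
  is-w : InWC≡ w
  is-c : InWC≡ c
  is-eqv : InWC≡ eqv

data Target : RuleName → Set where
  t-w∀ : Target w∀
  t-c∀ : Target c∀
  t-m  : Target m
  t-m∀ : Target m∀
  t-m∃ : Target m∃

StepWC≡ : Formula → Formula → Set
StepWC≡ P Q = ∃[ r ] (InWC≡ r × Step r P Q)

DerivWC≡ : Formula → Formula → Set
DerivWC≡ = Star StepWC≡

-- Each rule is simulated locally: weaken the premise by the components the
-- conclusion is missing, permute the result with ≡ until it has the form X ∨ X,
-- and contract.  For w∀ and c∀ the quantifier is moved across a disjunct with
-- the scope equation ∀x.(A ∨ B) ≡ (∀x.A) ∨ B.  Since every step of {w, c, ≡}
-- may happen inside an arbitrary context, these derivations lift to the
-- contexts of the rule instances.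
module Submission where

open import Defs
open import Data.Product using (_,_)
open import Relation.Binary.PropositionalEquality using (_≡_; refl; cong; sym)
open import Relation.Nullary using (¬_)
open import Relation.Binary.Construct.Closure.ReflexiveTransitive using (gmap)
open import Relation.Binary.Construct.Closure.ReflexiveTransitive.Properties using (module StarReasoning)

infixr 9 _⊚_

_⊚_ : Context → Context → Context
□ ⊚ T = T
(S ∧ₗ B) ⊚ T = (S ⊚ T) ∧ₗ B
(B ∧ᵣ S) ⊚ T = B ∧ᵣ (S ⊚ T)
(S ∨ₗ B) ⊚ T = (S ⊚ T) ∨ₗ B
(B ∨ᵣ S) ⊚ T = B ∨ᵣ (S ⊚ T)
exC x S ⊚ T = exC x (S ⊚ T)
allC x S ⊚ T = allC x (S ⊚ T)

⊚-plug : ∀ S T A → (S ⊚ T) [ A ] ≡ S [ T [ A ] ]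
⊚-plug □ T A = refl
⊚-plug (S ∧ₗ B) T A = cong (_∧ B) (⊚-plug S T A)
⊚-plug (B ∧ᵣ S) T A = cong (B ∧_) (⊚-plug S T A)
⊚-plug (S ∨ₗ B) T A = cong (_∨ B) (⊚-plug S T A)
⊚-plug (B ∨ᵣ S) T A = cong (B ∨_) (⊚-plug S T A)
⊚-plug (exC x S) T A = cong (ex x) (⊚-plug S T A)
⊚-plug (allC x S) T A = cong (all x) (⊚-plug S T A)

stepWC≡-plug : ∀ S {P Q} → StepWC≡ P Q → StepWC≡ (S [ P ]) (S [ Q ])
stepWC≡-plug S (r , r∈WC≡ , T , A , B , inst , refl , refl) =
  r , r∈WC≡ , S ⊚ T , A , B , inst , sym (⊚-plug S T A) , sym (⊚-plug S T B)

derivWC≡-plug : ∀ S {P Q} → DerivWC≡ P Q → DerivWC≡ (S [ P ]) (S [ Q ])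
derivWC≡-plug S = gmap (S [_]) (stepWC≡-plug S)

weaken : ∀ S {A B} → StepWC≡ (S [ A ]) (S [ A ∨ B ])
weaken S = w , is-w , S , _ , _ , w-inst , refl , refl

contract : ∀ S {A} → StepWC≡ (S [ A ∨ A ]) (S [ A ])
contract S = c , is-c , S , _ , _ , c-inst , refl , refl

rearrange : ∀ {P Q} → Q ≈ P → StepWC≡ P Q
rearrange Q≈P = eqv , is-eqv , □ , _ , _ , eqv-inst Q≈P , refl , refl

¬Free-all : ∀ {x A} → ¬ Free x (all x A)
¬Free-all (inAll x≢x _) = x≢x refl

open StarReasoning StepWC≡

inst-derivable : ∀ {r} → Target r → ∀ {P Q} → Inst r P Q → DerivWC≡ P Q
inst-derivable t-w∀ (w∀-inst {x} {A} x∉A) = begin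
  A                  ⟶⟨ weaken □ ⟩
  A ∨ all x A        ⟶⟨ rearrange (≈-trans (all-scope x∉A) ∨-comm) ⟩
  all x (A ∨ A)      ⟶⟨ contract (allC x □) ⟩
  all x A            ∎
inst-derivable t-c∀ (c∀-inst {x} {A}) = begin
  all x (all x A)          ⟶⟨ weaken (allC x □) ⟩
  all x (all x A ∨ A)      ⟶⟨ rearrange (≈-sym (≈-trans (all-cong ∨-comm) (all-scope ¬Free-all))) ⟩
  all x A ∨ all x A        ⟶⟨ contract □ ⟩
  all x A                  ∎
inst-derivable t-m (m-inst {A} {B} {C} {D}) = begin
  (A ∧ C) ∨ (B ∧ D)                                      ⟶⟨ weaken ((□ ∧ₗ C) ∨ₗ (B ∧ D)) ⟩
  ((A ∨ B) ∧ C) ∨ (B ∧ D)                                ⟶⟨ weaken (((A ∨ B) ∧ᵣ □) ∨ₗ (B ∧ D)) ⟩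
  ((A ∨ B) ∧ (C ∨ D)) ∨ (B ∧ D)                          ⟶⟨ weaken (((A ∨ B) ∧ (C ∨ D)) ∨ᵣ (□ ∧ₗ D)) ⟩
  ((A ∨ B) ∧ (C ∨ D)) ∨ ((B ∨ A) ∧ D)                    ⟶⟨ weaken (((A ∨ B) ∧ (C ∨ D)) ∨ᵣ ((B ∨ A) ∧ᵣ □)) ⟩
  ((A ∨ B) ∧ (C ∨ D)) ∨ ((B ∨ A) ∧ (D ∨ C))              ⟶⟨ rearrange (∨-cong ≈-refl (∧-cong ∨-comm ∨-comm)) ⟩
  ((A ∨ B) ∧ (C ∨ D)) ∨ ((A ∨ B) ∧ (C ∨ D))              ⟶⟨ contract □ ⟩
  (A ∨ B) ∧ (C ∨ D)                                      ∎
inst-derivable t-m∀ (m∀-inst {x} {A} {B}) = begin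
  all x A ∨ all x B                      ⟶⟨ weaken (allC x □ ∨ₗ all x B) ⟩
  all x (A ∨ B) ∨ all x B                ⟶⟨ weaken (all x (A ∨ B) ∨ᵣ allC x □) ⟩
  all x (A ∨ B) ∨ all x (B ∨ A)          ⟶⟨ rearrange (∨-cong ≈-refl (all-cong ∨-comm)) ⟩
  all x (A ∨ B) ∨ all x (A ∨ B)          ⟶⟨ contract □ ⟩
  all x (A ∨ B)                          ∎
inst-derivable t-m∃ (m∃-inst {x} {A} {B}) = begin
  ex x A ∨ ex x B                        ⟶⟨ weaken (exC x □ ∨ₗ ex x B) ⟩
  ex x (A ∨ B) ∨ ex x B                  ⟶⟨ weaken (ex x (A ∨ B) ∨ᵣ exC x □) ⟩
  ex x (A ∨ B) ∨ ex x (B ∨ A)            ⟶⟨ rearrange (∨-cong ≈-refl (ex-cong ∨-comm)) ⟩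
  ex x (A ∨ B) ∨ ex x (A ∨ B)            ⟶⟨ contract □ ⟩
  ex x (A ∨ B)                           ∎

lemma7p7 : ∀ {r} → Target r → ∀ {P Q} → Step r P Q → DerivWC≡ P Q
lemma7p7 t (S , A , B , inst , refl , refl) = derivWC≡-plug S (inst-derivable t inst)
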